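{- Let $r$, $\alpha$, $p$ be nonnegative integers such that $r+1$ and $p$ are both prime. Then $(r+1)^{\alpha}p$ is a Schemmel nontotient number of order $r$ if and only if, for every nonnegative integer $t \le \alpha$, we have $p \neq (r+1)^t + r$ and $(r+1)^t p + r$ is not prime.
   Context: For a positive integer $r$, the Schemmel totient function $S_r$ is the multiplicative arithmetic function determined by $S_r(p^{\alpha}) = 0$ if $p \le r$ and $S_r(p^{\alpha}) = p^{\alpha-1}(p-r)$ if $p > r$, for all primes $p$ and positive integers $\alpha$ (and $S_r(1)=1$). A Schemmel nontotient number of order $r$ is a positive integer not in the range of $S_r$. -}

module Defs where

open import Data.Nat using (ℕ; zero; suc; _+_; _*_; _∸_; _^_; _≤_; _<_; _≤ᵇ_)
open import Data.Nat.Divisibility using (_∣_; _∣?_)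
open import Data.Nat.Primality using (Prime; prime?)
open import Data.List using (List; map; filter; upTo)
open import Data.Nat.ListAction using (product)
open import Data.Product using (_×_)
open import Relation.Nullary using (¬_; Dec; does)
open import Relation.Nullary.Decidable using (_×-dec_)
open import Relation.Binary.PropositionalEquality using (_≡_)
open import Data.Bool using (if_then_else_)

-- p-adic valuation of n (for p ≥ 2, n ≥ 1): the largest k ≤ n with p ^ k ∣ n.
-- valAux p n k  = largest j ≤ k with p ^ j ∣ n (0 if none besides j = 0).
valAux : ℕ → ℕ → ℕ → ℕ
valAux p n zero = zero
valAux p n (suc k) = if does ((p ^ suc k) ∣? n) then suc k else valAux p n k

val : ℕ → ℕ → ℕ
val p n = valAux p n n

Sₚ : ℕ → ℕ → ℕ → ℕ
Sₚ r p α = if p ≤ᵇ r then 0 else p ^ (α ∸ 1) * (p ∸ r)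

primeDivisors : ℕ → List ℕ
primeDivisors n = filter (λ p → prime? p ×-dec (p ∣? n)) (upTo (suc n))

-- The Schemmel totient function S_r(n), for n ≥ 1, as the multiplicative
-- function determined by its values on prime powers: product over the
-- prime-power factors p ^ v_p(n) of n.  (S_r(1) = 1: empty product.)
S : ℕ → ℕ → ℕ
S r n = product (map (λ p → Sₚ r p (val p n)) (primeDivisors n))

SchemmelNontotient : ℕ → ℕ → Set
SchemmelNontotient r m = 1 ≤ m × ((n : ℕ) → 1 ≤ n → ¬ (S r n ≡ m))

-- Write P = r + 1. On prime powers S_r(P^(k+1)) = P^k, and for a prime q > P,
-- S_r(q^(k+1) P^(e+1)) = q^k (q − r) P^e. With t + e = α this realises P^α p as
-- S_r(P^(α+2)) when p = P, as S_r(p² P^(e+1)) when p = P^t + r with t ≥ 1, and as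
-- S_r(q P^(e+1)) when q = P^t p + r is prime. Conversely, if S_r(n) = P^α p, then p divides
-- a factor q^k (q − r) of S_r(n) for some prime q > r: either p = q, and then q − r, being
-- coprime to p, divides P^α; or q − r = c p with c ∣ P^α. Divisors of P^α are powers P^t.
module Submission where

open import Defs
open import Data.Bool using (true; false)
open import Data.Empty using (⊥-elim)
open import Data.List using ([]; _∷_; [_]; map; upTo)
open import Data.List.Membership.Propositional using (_∈_)
open import Data.List.Membership.Propositional.Properties
  using (∈-map⁻; ∈-filter⁺; ∈-filter⁻; ∈-upTo⁺)
open import Data.List.Membership.Propositional.Properties.WithK using (unique∧set⇒bag)
open import Data.List.Relation.Binary.BagAndSetEquality using (∼bag⇒↭)
open import Data.List.Relation.Binary.Permutation.Propositional.Properties using (map⁺)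
open import Data.List.Relation.Unary.Any using (here; there)
open import Data.List.Relation.Unary.All using ([]; _∷_)
open import Data.List.Relation.Unary.AllPairs using ([]; _∷_)
open import Data.List.Relation.Unary.Unique.Propositional using (Unique)
open import Data.List.Relation.Unary.Unique.Propositional.Properties using (filter⁺; upTo⁺)
open import Data.Nat
  using (ℕ; zero; suc; _+_; _*_; _∸_; _^_; _≤_; _<_; _≤ᵇ_; z≤n; s≤s; NonZero; ≢-nonZero; ≢-nonZero⁻¹; >-nonZero⁻¹; >-nonZero; nonTrivial⇒n>1)
open import Data.Nat.Properties
open import Data.Nat.Divisibility
open import Data.Nat.Primality
open import Data.Nat.Coprimality using (coprime-divisor; prime⇒coprime)
import Data.Nat.Coprimality as Coprime
open import Data.Nat.ListAction using (product)
open import Data.Nat.ListAction.Properties using (∈⇒∣product; product-↭)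
open import Data.Nat.Tactic.RingSolver using (solve-∀)
open import Data.Product using (_×_; _,_; ∃-syntax; proj₁; proj₂)
open import Data.Sum using (_⊎_; inj₁; inj₂)
open import Function.Bundles using (_⇔_; mk⇔; Equivalence)
open import Function.Construct.Composition using (_⇔-∘_)
open import Function.Construct.Symmetry using (⇔-sym)
open import Relation.Nullary using (¬_; yes; no; _×-dec_)
open import Relation.Nullary.Reflects using (ofʸ; ofⁿ)
open import Relation.Binary.PropositionalEquality
  using (_≡_; _≢_; refl; sym; trans; cong; cong₂; subst; module ≡-Reasoning)

prime⇒>1 : ∀ {p} → Prime p → 1 < p
prime⇒>1 {p} (prime _) = nonTrivial⇒n>1 p

prime∤1 : ∀ {p} → Prime p → ¬ p ∣ 1
prime∤1 pp p∣1 = <-irrefl (sym (∣1⇒≡1 p∣1)) (prime⇒>1 pp)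

prime∣prime⇒≡ : ∀ {p q} → Prime p → Prime q → p ∣ q → p ≡ q
prime∣prime⇒≡ pp pq p∣q with prime⇒irreducible pq p∣q
... | inj₂ p≡q = p≡q
... | inj₁ refl = ⊥-elim (<-irrefl refl (prime⇒>1 pp))

prime∣^⇒∣ : ∀ {p m} n → Prime p → p ∣ m ^ n → p ∣ m
prime∣^⇒∣ zero    pp p∣1 = ⊥-elim (prime∤1 pp p∣1)
prime∣^⇒∣ {m = m} (suc n) pp p∣m^sn with euclidsLemma m (m ^ n) pp p∣m^sn
... | inj₁ p∣m   = p∣m
... | inj₂ p∣m^n = prime∣^⇒∣ n pp p∣m^n

prime∣product⇒∈ : ∀ {p} → Prime p → ∀ ns → p ∣ product ns → ∃[ n ] n ∈ ns × p ∣ n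
prime∣product⇒∈ pp []       p∣1 = ⊥-elim (prime∤1 pp p∣1)
prime∣product⇒∈ pp (n ∷ ns) p∣n*Π with euclidsLemma n (product ns) pp p∣n*Π
... | inj₁ p∣n = n , here refl , p∣n
... | inj₂ p∣Π with m , m∈ns , p∣m ← prime∣product⇒∈ pp ns p∣Π = m , there m∈ns , p∣m

∣prime^⇒≡prime^ : ∀ {q} → Prime q → ∀ n {d} → d ∣ q ^ n → ∃[ t ] t ≤ n × d ≡ q ^ t
∣prime^⇒≡prime^ pq zero d∣1 = 0 , z≤n , ∣1⇒≡1 d∣1
∣prime^⇒≡prime^ {q} pq (suc n) {d} d∣q^sn with q ∣? d
... | yes (divides e refl) =
  let instance _ = prime⇒nonZero pq
      t , t≤n , e≡q^t = ∣prime^⇒≡prime^ pq n {e} (*-cancelʳ-∣ q (subst (e * q ∣_) (*-comm q (q ^ n)) d∣q^sn))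
  in suc t , s≤s t≤n , trans (cong (_* q) e≡q^t) (*-comm (q ^ t) q)
... | no q∤d =
  let t , t≤n , d≡q^t = ∣prime^⇒≡prime^ pq n (coprime-divisor coprime d∣q^sn)
  in t , m≤n⇒m≤1+n t≤n , d≡q^t
  where
  coprime : Coprime.Coprime d q
  coprime (i∣d , i∣q) with prime⇒irreducible pq i∣q
  ... | inj₁ i≡1 = i≡1
  ... | inj₂ refl = ⊥-elim (q∤d i∣d)

n<m^n : ∀ {m} → 1 < m → ∀ n → n < m ^ n
n<m^n 1<m zero    = s≤s z≤n
n<m^n {m} 1<m (suc n) = begin-strict
  suc n            <⟨ +-monoʳ-< 1 (n<m^n 1<m n) ⟩
  1 + m ^ n        ≤⟨ +-monoˡ-≤ (m ^ n) (≤-trans (s≤s z≤n) (n<m^n 1<m n)) ⟩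
  m ^ n + m ^ n    ≡⟨ cong (m ^ n +_) (sym (+-identityʳ (m ^ n))) ⟩
  2 * m ^ n        ≤⟨ *-monoˡ-≤ (m ^ n) 1<m ⟩
  m * m ^ n        ∎
  where open ≤-Reasoning

^-monoʳ-∣ : ∀ m {i j} → i ≤ j → m ^ i ∣ m ^ j
^-monoʳ-∣ m {i} i≤j with o , refl ← m≤n⇒∃[o]m+o≡n i≤j =
  divides (m ^ o) (trans (^-distribˡ-+-* m i o) (*-comm (m ^ i) (m ^ o)))

valAux-exact : ∀ {p n k} N → k ≤ N → p ^ k ∣ n → (∀ j → k < j → ¬ p ^ j ∣ n) → valAux p n N ≡ k
valAux-exact zero z≤n _ _ = refl
valAux-exact {p} {n} {k} (suc N) k≤1+N p^k∣n above with (p ^ suc N) ∣? n | k ≟ suc N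
... | yes _      | yes refl  = refl
... | no p^k∤n   | yes refl  = ⊥-elim (p^k∤n p^k∣n)
... | yes p^N∣n  | no k≢1+N  = ⊥-elim (above (suc N) (≤∧≢⇒< k≤1+N k≢1+N) p^N∣n)
... | no _       | no k≢1+N  = valAux-exact N (≤-pred (≤∧≢⇒< k≤1+N k≢1+N)) p^k∣n above

val-exact : ∀ {p n k} → 1 < p → .{{NonZero n}} → p ^ k ∣ n → ¬ p ^ suc k ∣ n → val p n ≡ k
val-exact {p} {n} {k} 1<p p^k∣n p^1+k∤n = valAux-exact n k≤n p^k∣n above
  where
  k≤n : k ≤ n
  k≤n = <⇒≤ (<-≤-trans (n<m^n 1<p k) (∣⇒≤ p^k∣n))
  above : ∀ j → k < j → ¬ p ^ j ∣ n
  above j k<j p^j∣n = p^1+k∤n (∣-trans (^-monoʳ-∣ p k<j) p^j∣n)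

val-^*coprime : ∀ {p m} k → Prime p → .{{NonZero m}} → ¬ p ∣ m → val p (p ^ k * m) ≡ k
val-^*coprime {p} {m} k pp p∤m = val-exact (prime⇒>1 pp) (m∣m*n m) p^1+k∤p^k*m
  where
  instance
    _ = prime⇒nonZero pp
    p^k≢0 = m^n≢0 p k
    _ = m*n≢0 (p ^ k) m
  p^1+k∤p^k*m : ¬ p ^ suc k ∣ p ^ k * m
  p^1+k∤p^k*m p^1+k∣ = p∤m (*-cancelˡ-∣ (p ^ k) (subst (_∣ p ^ k * m) (*-comm p (p ^ k)) p^1+k∣))

Sₚ-≤ : ∀ {r q} v → q ≤ r → Sₚ r q v ≡ 0
Sₚ-≤ {r} {q} v q≤r with q ≤ᵇ r | ≤ᵇ-reflects-≤ q r
... | true  | _      = refl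
... | false | ofⁿ q≰r = ⊥-elim (q≰r q≤r)

Sₚ-> : ∀ {r q} v → r < q → Sₚ r q v ≡ q ^ (v ∸ 1) * (q ∸ r)
Sₚ-> {r} {q} v r<q with q ≤ᵇ r | ≤ᵇ-reflects-≤ q r
... | true  | ofʸ q≤r = ⊥-elim (<⇒≱ r<q q≤r)
... | false | _       = refl

S-factor : ℕ → ℕ → ℕ → ℕ
S-factor r n q = Sₚ r q (val q n)

primeDivisors-unique : ∀ n → Unique (primeDivisors n)
primeDivisors-unique n = filter⁺ (λ p → prime? p ×-dec (p ∣? n)) (upTo⁺ (suc n))

∈-primeDivisors⇔ : ∀ {n x} → .{{NonZero n}} → x ∈ primeDivisors n ⇔ (Prime x × x ∣ n)
∈-primeDivisors⇔ {n} = mk⇔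
  (λ x∈ → proj₂ (∈-filter⁻ P? {xs = upTo (suc n)} x∈))
  (λ (px , x∣n) → ∈-filter⁺ P? (∈-upTo⁺ (s≤s (∣⇒≤ x∣n))) (px , x∣n))
  where
  P? = λ p → prime? p ×-dec (p ∣? n)

S-over-primeDivisors : ∀ r {n ps} → .{{NonZero n}} → Unique ps →
  (∀ {x} → x ∈ ps ⇔ (Prime x × x ∣ n)) →
  S r n ≡ product (map (S-factor r n) ps)
S-over-primeDivisors r {n} unique-ps ∈ps⇔ =
  product-↭ (map⁺ (S-factor r n) (∼bag⇒↭ (unique∧set⇒bag
    (primeDivisors-unique n) unique-ps (⇔-sym ∈ps⇔ ⇔-∘ ∈-primeDivisors⇔))))

S-prime^ : ∀ r {a} i → Prime a → S r (a ^ suc i) ≡ Sₚ r a (suc i)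
S-prime^ r {a} i pa = begin
  S r (a ^ suc i)                           ≡⟨ S-over-primeDivisors r ([] ∷ []) (mk⇔ to from) ⟩
  Sₚ r a (val a (a ^ suc i)) * 1            ≡⟨ *-identityʳ _ ⟩
  Sₚ r a (val a (a ^ suc i))                ≡⟨ cong (Sₚ r a) val≡ ⟩
  Sₚ r a (suc i)                            ∎
  where
  open ≡-Reasoning
  instance
    _ = prime⇒nonZero pa
    _ = m^n≢0 a (suc i)
  to : ∀ {x} → x ∈ [ a ] → Prime x × x ∣ a ^ suc i
  to (here refl) = pa , m∣m*n (a ^ i)
  from : ∀ {x} → Prime x × x ∣ a ^ suc i → x ∈ [ a ]
  from (px , x∣a^) = here (prime∣prime⇒≡ px pa (prime∣^⇒∣ (suc i) px x∣a^))
  val≡ : val a (a ^ suc i) ≡ suc i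
  val≡ = trans (cong (val a) (sym (*-identityʳ (a ^ suc i)))) (val-^*coprime (suc i) pa (prime∤1 pa))

S-prime^*prime^ : ∀ r {a b} i j → Prime a → Prime b → a ≢ b →
  S r (a ^ suc i * b ^ suc j) ≡ Sₚ r a (suc i) * Sₚ r b (suc j)
S-prime^*prime^ r {a} {b} i j pa pb a≢b = begin
  S r n                                                 ≡⟨ S-over-primeDivisors r ((a≢b ∷ []) ∷ [] ∷ []) (mk⇔ to from) ⟩
  Sₚ r a (val a n) * (Sₚ r b (val b n) * 1)             ≡⟨ cong (Sₚ r a (val a n) *_) (*-identityʳ _) ⟩
  Sₚ r a (val a n) * Sₚ r b (val b n)                   ≡⟨ cong₂ (λ u v → Sₚ r a u * Sₚ r b v) val-a val-b ⟩
  Sₚ r a (suc i) * Sₚ r b (suc j)                       ∎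
  where
  open ≡-Reasoning
  instance
    _ = prime⇒nonZero pa
    _ = prime⇒nonZero pb
    a^≢0 = m^n≢0 a (suc i)
    b^≢0 = m^n≢0 b (suc j)
    _ = m*n≢0 (a ^ suc i) (b ^ suc j)
  n = a ^ suc i * b ^ suc j
  to : ∀ {x} → x ∈ a ∷ b ∷ [] → Prime x × x ∣ n
  to (here refl)         = pa , ∣-trans (m∣m*n (a ^ i)) (m∣m*n (b ^ suc j))
  to (there (here refl)) = pb , ∣-trans (m∣m*n (b ^ j)) (n∣m*n (a ^ suc i))
  from : ∀ {x} → Prime x × x ∣ n → x ∈ a ∷ b ∷ []
  from (px , x∣n) with euclidsLemma (a ^ suc i) (b ^ suc j) px x∣n
  ... | inj₁ x∣a^ = here (prime∣prime⇒≡ px pa (prime∣^⇒∣ (suc i) px x∣a^))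
  ... | inj₂ x∣b^ = there (here (prime∣prime⇒≡ px pb (prime∣^⇒∣ (suc j) px x∣b^)))
  val-a : val a n ≡ suc i
  val-a = val-^*coprime (suc i) pa (λ a∣b^ → a≢b (prime∣prime⇒≡ pa pb (prime∣^⇒∣ (suc j) pa a∣b^)))
  val-b : val b n ≡ suc j
  val-b = trans (cong (val b) (*-comm (a ^ suc i) (b ^ suc j)))
    (val-^*coprime (suc j) pb (λ b∣a^ → a≢b (sym (prime∣prime⇒≡ pb pa (prime∣^⇒∣ (suc i) pb b∣a^)))))

prime∣S⇒∣factor : ∀ r {n m p} → .{{NonZero m}} → .{{NonZero n}} → Prime p → S r n ≡ m → p ∣ m →
  ∃[ q ] ∃[ k ] Prime q × r < q × p ∣ q ^ k * (q ∸ r) × q ^ k * (q ∸ r) ∣ m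
prime∣S⇒∣factor r {n} {m} {p} pp refl p∣S
  with y , y∈ , p∣y ← prime∣product⇒∈ pp (map (S-factor r n) (primeDivisors n)) p∣S
  with q , q∈ , refl ← ∈-map⁻ (S-factor r n) y∈
  with q ≤? r
... | yes q≤r = ⊥-elim (≢-nonZero⁻¹ m (0∣⇒≡0 (subst (_∣ m) (Sₚ-≤ (val q n) q≤r) (∈⇒∣product y∈))))
... | no q≰r  =
  q , val q n ∸ 1 , proj₁ (Equivalence.to ∈-primeDivisors⇔ q∈) , ≰⇒> q≰r ,
  subst (p ∣_) factor≡ p∣y , subst (_∣ m) factor≡ (∈⇒∣product y∈)
  where
  factor≡ : S-factor r n q ≡ q ^ (val q n ∸ 1) * (q ∸ r)
  factor≡ = Sₚ-> (val q n) (≰⇒> q≰r)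

m∸n≡o⇒m≡o+n : ∀ {m n o} → n ≤ m → m ∸ n ≡ o → m ≡ o + n
m∸n≡o⇒m≡o+n {n = n} n≤m m∸n≡o = trans (sym (m∸n+n≡m n≤m)) (cong (_+ n) m∸n≡o)

S-preimage-[1+r]^α*p : ∀ r α {n p} → .{{NonZero n}} → Prime (suc r) → Prime p →
  S r n ≡ suc r ^ α * p → ∃[ t ] t ≤ α × (p ≡ suc r ^ t + r ⊎ Prime (suc r ^ t * p + r))
S-preimage-[1+r]^α*p r α {n} {p} pP pp S≡m
  with q , k , pq , r<q , p∣f , f∣m ←
       prime∣S⇒∣factor r {n} {{m*n≢0 (suc r ^ α) p {{m^n≢0 (suc r) α}} {{prime⇒nonZero pp}}}}
         pp S≡m (n∣m*n (suc r ^ α))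
  with euclidsLemma (q ^ k) (q ∸ r) pp p∣f
... | inj₁ p∣q^k with refl ← prime∣prime⇒≡ pp pq (prime∣^⇒∣ k pp p∣q^k) =
  let instance _ = ≢-nonZero (m>n⇒m∸n≢0 r<q)
      0<r = prime⇒>1 pP
      coprime = Coprime.sym (prime⇒coprime pp (∸-monoʳ-< {p} {r} {0} (≤-pred 0<r) (<⇒≤ r<q)))
      p∸r∣p*P^α = subst (p ∸ r ∣_) (*-comm (suc r ^ α) p) (∣-trans (n∣m*n (p ^ k)) f∣m)
      t , t≤α , p∸r≡P^t = ∣prime^⇒≡prime^ pP α (coprime-divisor coprime p∸r∣p*P^α)
  in t , t≤α , inj₁ (m∸n≡o⇒m≡o+n (<⇒≤ r<q) p∸r≡P^t)
... | inj₂ (divides c q∸r≡c*p) =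
  let instance _ = prime⇒nonZero pp
      c*p∣P^α*p = subst (_∣ suc r ^ α * p) q∸r≡c*p (∣-trans (n∣m*n (q ^ k)) f∣m)
      t , t≤α , c≡P^t = ∣prime^⇒≡prime^ pP α {c} (*-cancelʳ-∣ p c*p∣P^α*p)
  in t , t≤α , inj₂ (subst Prime (m∸n≡o⇒m≡o+n (<⇒≤ r<q) (trans q∸r≡c*p (cong (_* p) c≡P^t))) pq)

SchemmelTotient : ℕ → ℕ → Set
SchemmelTotient r m = ∃[ n ] 1 ≤ n × S r n ≡ m

S-[1+r]^[2+α] : ∀ r α → Prime (suc r) → S r (suc r ^ suc (suc α)) ≡ suc r ^ α * suc r
S-[1+r]^[2+α] r α pP = begin
  S r (suc r ^ suc (suc α))         ≡⟨ S-prime^ r (suc α) pP ⟩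
  Sₚ r (suc r) (suc (suc α))        ≡⟨ Sₚ-> (suc (suc α)) ≤-refl ⟩
  suc r ^ suc α * (suc r ∸ r)       ≡⟨ cong (suc r ^ suc α *_) (m+n∸n≡m 1 r) ⟩
  suc r ^ suc α * 1                 ≡⟨ *-identityʳ _ ⟩
  suc r * suc r ^ α                 ≡⟨ *-comm (suc r) _ ⟩
  suc r ^ α * suc r                 ∎
  where open ≡-Reasoning

S-q^[1+k]*[1+r]^[1+e] : ∀ r k e {q} → Prime (suc r) → Prime q → suc r < q →
  S r (q ^ suc k * suc r ^ suc e) ≡ q ^ k * (q ∸ r) * suc r ^ e
S-q^[1+k]*[1+r]^[1+e] r k e {q} pP pq 1+r<q = begin
  S r (q ^ suc k * suc r ^ suc e)                 ≡⟨ S-prime^*prime^ r k e pq pP (>⇒≢ 1+r<q) ⟩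
  Sₚ r q (suc k) * Sₚ r (suc r) (suc e)           ≡⟨ cong₂ _*_ (Sₚ-> (suc k) (<⇒≤ 1+r<q)) (Sₚ-> (suc e) ≤-refl) ⟩
  q ^ k * (q ∸ r) * (suc r ^ e * (suc r ∸ r))     ≡⟨ cong (λ x → q ^ k * (q ∸ r) * (suc r ^ e * x)) (m+n∸n≡m 1 r) ⟩
  q ^ k * (q ∸ r) * (suc r ^ e * 1)               ≡⟨ cong (q ^ k * (q ∸ r) *_) (*-identityʳ _) ⟩
  q ^ k * (q ∸ r) * suc r ^ e                     ∎
  where open ≡-Reasoning

totient-if-p≡[1+r]^t+r : ∀ r α t {p} → Prime (suc r) → Prime p → t ≤ α →
  p ≡ suc r ^ t + r → SchemmelTotient r (suc r ^ α * p)
totient-if-p≡[1+r]^t+r r α zero pP pp t≤α refl =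
  suc r ^ suc (suc α) , >-nonZero⁻¹ _ {{m^n≢0 (suc r) (suc (suc α))}} , S-[1+r]^[2+α] r α pP
totient-if-p≡[1+r]^t+r r α (suc t) {p} pP pp t≤α p≡
  with e , refl ← m≤n⇒∃[o]m+o≡n t≤α =
  p ^ 2 * P ^ suc e , >-nonZero⁻¹ _ {{m*n≢0 (p ^ 2) (P ^ suc e) {{m^n≢0 p 2}} {{m^n≢0 P (suc e)}}}} , (begin
    S r (p ^ 2 * P ^ suc e)      ≡⟨ S-q^[1+k]*[1+r]^[1+e] r 1 e pP pp P<p ⟩
    p ^ 1 * (p ∸ r) * P ^ e      ≡⟨ cong (λ x → p ^ 1 * x * P ^ e) p∸r≡P^t ⟩
    p ^ 1 * P ^ suc t * P ^ e    ≡⟨ reorder p (P ^ suc t) (P ^ e) ⟩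
    P ^ suc t * P ^ e * p        ≡⟨ cong (_* p) (^-distribˡ-+-* P (suc t) e) ⟨
    P ^ (suc t + e) * p          ∎)
  where
  open ≡-Reasoning
  P = suc r
  instance _ = prime⇒nonZero pp
  P<p : P < p
  P<p = subst (P <_) (sym p≡)
    (<-≤-trans (m<m+n P (≤-pred (prime⇒>1 pP))) (+-monoˡ-≤ r (m≤m*n P (P ^ t) {{m^n≢0 P t}})))
  p∸r≡P^t : p ∸ r ≡ P ^ suc t
  p∸r≡P^t = trans (cong (_∸ r) p≡) (m+n∸n≡m (P ^ suc t) r)
  reorder : ∀ p x y → p * 1 * x * y ≡ x * y * p
  reorder = solve-∀

totient-if-prime[[1+r]^t*p+r] : ∀ r α t {p} → Prime (suc r) → Prime p → t ≤ α →
  Prime (suc r ^ t * p + r) → SchemmelTotient r (suc r ^ α * p)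
totient-if-prime[[1+r]^t*p+r] r α t {p} pP pp t≤α pq
  with e , refl ← m≤n⇒∃[o]m+o≡n t≤α =
  q ^ 1 * P ^ suc e , >-nonZero⁻¹ _ {{m*n≢0 (q ^ 1) (P ^ suc e) {{m^n≢0 q 1}} {{m^n≢0 P (suc e)}}}} , (begin
    S r (q ^ 1 * P ^ suc e)      ≡⟨ S-q^[1+k]*[1+r]^[1+e] r 0 e pP pq P<q ⟩
    q ^ 0 * (q ∸ r) * P ^ e      ≡⟨ cong (λ x → q ^ 0 * x * P ^ e) (m+n∸n≡m (P ^ t * p) r) ⟩
    1 * (P ^ t * p) * P ^ e      ≡⟨ reorder (P ^ t) p (P ^ e) ⟩
    P ^ t * P ^ e * p            ≡⟨ cong (_* p) (^-distribˡ-+-* P t e) ⟨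
    P ^ (t + e) * p              ∎)
  where
  open ≡-Reasoning
  P = suc r
  q = P ^ t * p + r
  instance _ = prime⇒nonZero pq
  P<q : P < q
  P<q = +-monoˡ-≤ r (*-mono-≤ (>-nonZero⁻¹ (P ^ t) {{m^n≢0 P t}}) (prime⇒>1 pp))
  reorder : ∀ x p y → 1 * (x * p) * y ≡ x * y * p
  reorder = solve-∀

lemma2p2 : (r α p : ℕ) → Prime (suc r) → Prime p →
    SchemmelNontotient r (suc r ^ α * p) ⇔
      ((t : ℕ) → t ≤ α → (p ≢ suc r ^ t + r) × ¬ Prime (suc r ^ t * p + r))
lemma2p2 r α p pP pp = mk⇔ nontotient⇒conditions conditions⇒nontotient
  where
  nontotient⇒conditions : SchemmelNontotient r (suc r ^ α * p) →
    (t : ℕ) → t ≤ α → (p ≢ suc r ^ t + r) × ¬ Prime (suc r ^ t * p + r)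
  nontotient⇒conditions (_ , not-S) t t≤α =
      (λ p≡ → not-totient (totient-if-p≡[1+r]^t+r r α t pP pp t≤α p≡))
    , (λ pq → not-totient (totient-if-prime[[1+r]^t*p+r] r α t pP pp t≤α pq))
    where
    not-totient : ¬ SchemmelTotient r (suc r ^ α * p)
    not-totient (n , 1≤n , S≡m) = not-S n 1≤n S≡m

  conditions⇒nontotient : ((t : ℕ) → t ≤ α → (p ≢ suc r ^ t + r) × ¬ Prime (suc r ^ t * p + r)) →
    SchemmelNontotient r (suc r ^ α * p)
  conditions⇒nontotient conditions =
    >-nonZero⁻¹ _ {{m*n≢0 (suc r ^ α) p {{m^n≢0 (suc r) α}} {{prime⇒nonZero pp}}}} , not-S
    where
    not-S : (n : ℕ) → 1 ≤ n → ¬ S r n ≡ suc r ^ α * p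
    not-S n 1≤n S≡m with S-preimage-[1+r]^α*p r α {{>-nonZero 1≤n}} pP pp S≡m
    ... | t , t≤α , inj₁ p≡       = proj₁ (conditions t t≤α) p≡
    ... | t , t≤α , inj₂ prime-q  = proj₂ (conditions t t≤α) prime-q
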